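{- For every permutation $\pi$ of $\{1,\dots,n\}$, $$\operatorname{bc}(\pi)\ \ge\ \max\Big(\tfrac{\operatorname{bp}(\pi)}{3},\ \operatorname{des}(\pi),\ \tfrac{\operatorname{gap}(\pi)}{2},\ \operatorname{des}(\pi^{ -1}),\ \tfrac{\operatorname{gap}(\pi^{ -1})}{2}\Big).$$
   Context: Extend $\pi$ by $\pi_0=0$, $\pi_{n+1}=n+1$. A block move $(i,j,k)$ with $1\le i\le j<k\le n$ exchanges the adjacent blocks $\pi_i\dots\pi_j$ and $\pi_{j+1}\dots\pi_k$; it is monotone if $\pi_q>\pi_r$ for all $i\le q\le j<r\le k$. $\operatorname{bc}(\pi)$ is the minimum number of monotone block moves needed to transform $\pi$ into the identity permutation. For $0\le i\le n$, the adjacent pair $(\pi_i,\pi_{i+1})$ is a breakpoint if $\pi_{i+1}\ne\pi_i+1$; a breakpoint is a descent if $\pi_i>\pi_{i+1}$ and a gap otherwise. $\operatorname{bp}(\pi),\operatorname{des}(\pi),\operatorname{gap}(\pi)$ are the numbers of breakpoints, descents, gaps. $\pi^{ -1}$ is the inverse permutation ($\pi^{ -1}_{\pi_i}=i$), with the same conventions. -}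

module Defs where

open import Data.Nat using (ℕ; zero; suc; _+_; _*_; _<_; _≤_; _≟_; _<?_)
open import Data.Fin using (Fin; toℕ)
open import Data.Fin.Permutation using (Permutation′; _⟨$⟩ʳ_; _⟨$⟩ˡ_)
open import Data.List using (List; []; _∷_; _++_; map; allFin; upTo; [_])
open import Data.Nat.ListAction using (sum)
open import Data.Product using (_×_; _,_)
open import Data.List.Relation.Unary.All using (All)
open import Relation.Nullary using (¬_; yes; no)
open import Relation.Binary.PropositionalEquality using (_≡_)

oneLine : ∀ {n} → (Fin n → Fin n) → List ℕ
oneLine {n} f = map (λ i → suc (toℕ (f i))) (allFin n)

word : ∀ {n} → Permutation′ n → List ℕ
word π = oneLine (π ⟨$⟩ʳ_)

wordInv : ∀ {n} → Permutation′ n → List ℕ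
wordInv π = oneLine (π ⟨$⟩ˡ_)

idWord : ℕ → List ℕ
idWord n = map suc (upTo n)

extend : ℕ → List ℕ → List ℕ
extend n w = 0 ∷ (w ++ [ suc n ])

adjPairs : List ℕ → List (ℕ × ℕ)
adjPairs [] = []
adjPairs (x ∷ []) = []
adjPairs (x ∷ y ∷ w) = (x , y) ∷ adjPairs (y ∷ w)

isBp isDes isGap : ℕ × ℕ → ℕ
isBp (x , y) with y ≟ suc x
... | yes _ = 0
... | no  _ = 1
isDes (x , y) with y ≟ suc x | y <? x
... | no _ | yes _ = 1
... | _    | _     = 0
isGap (x , y) with y ≟ suc x | y <? x
... | no _ | no _ = 1
... | _    | _    = 0

countBp countDes countGap : List ℕ → ℕ
countBp  w = sum (map isBp  (adjPairs w))
countDes w = sum (map isDes (adjPairs w))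
countGap w = sum (map isGap (adjPairs w))

bp des gap : ∀ {n} → Permutation′ n → ℕ
bp  {n} π = countBp  (extend n (word π))
des {n} π = countDes (extend n (word π))
gap {n} π = countGap (extend n (word π))

bpInv desInv gapInv : ∀ {n} → Permutation′ n → ℕ
bpInv  {n} π = countBp  (extend n (wordInv π))
desInv {n} π = countDes (extend n (wordInv π))
gapInv {n} π = countGap (extend n (wordInv π))

-- A monotone block move: w = A ++ B ++ C ++ D with B = πᵢ…πⱼ, C = πⱼ₊₁…πₖ
-- both nonempty (i ≤ j < k), every entry of B larger than every entry of C;
-- the result is A ++ C ++ B ++ D.
data MonoMove : List ℕ → List ℕ → Set where
  move : (A : List ℕ) (b : ℕ) (B : List ℕ) (c : ℕ) (C D : List ℕ) →
         All (λ x → All (λ y → y < x) (c ∷ C)) (b ∷ B) →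
         MonoMove (A ++ (b ∷ B) ++ (c ∷ C) ++ D) (A ++ (c ∷ C) ++ (b ∷ B) ++ D)

data MonoMoves : ℕ → List ℕ → List ℕ → Set where
  done : ∀ {w} → MonoMoves 0 w w
  step : ∀ {m w w' w''} → MonoMove w w' → MonoMoves m w' w'' → MonoMoves (suc m) w w''

Sorts : ∀ {n} → Permutation′ n → ℕ → Set
Sorts {n} π m = MonoMoves m (word π) (idWord n)

IsBc : ∀ {n} → Permutation′ n → ℕ → Set
IsBc π m = Sorts π m × (∀ m′ → Sorts π m′ → m ≤ m′)

-- Every count in the statement is a potential on the extended word that a single
-- monotone block move can lower only by a bounded amount, and that vanishes on the
-- identity.  A move ABCD ↦ ACBD changes only the three adjacencies at the block
-- boundaries, so bp drops by at most 3; the new adjacency (last of C, first of B) is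
-- a descent, so gap drops by at most 2; and since C < B entrywise, the adjacencies
-- (last of A, first of B) and (last of C, first of D) become no less descending, so
-- des drops by at most 1.  The counts of π⁻¹ are read off the word of π through the
-- relative positions of the values v and v+1: a descent of π⁻¹ at v means v+1 occurs
-- before v.  A move puts v+1 before v only if v+1 ∈ B and v ∈ C, which by
-- monotonicity happens for at most one v; a gap of π⁻¹ at v (v before v+1, not
-- adjacent) can only be destroyed by the two adjacencies the move creates.

module Submission where

open import Defs
open import Data.Nat using (ℕ; zero; suc; _+_; _*_; _∸_; _≤_; _<_; _≟_; _<?_; z≤n; s≤s; s≤s⁻¹; z<s)
open import Data.Nat.Properties
open import Data.Nat.Tactic.RingSolver using (solve-∀)
open import Data.Fin using (Fin; toℕ; fromℕ<) renaming (zero to fzero; suc to fsuc)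
open import Data.Fin.Properties using (toℕ<n; toℕ-fromℕ<)
open import Data.Fin.Permutation using (Permutation′; _⟨$⟩ʳ_; _⟨$⟩ˡ_; inverseˡ; inverseʳ)
open import Data.List using (List; []; _∷_; _++_; [_]; map; applyUpTo; tabulate)
open import Data.Nat.ListAction using (sum)
open import Data.List.Properties using (++-assoc; map-tabulate; map-applyUpTo; applyUpTo-∷ʳ)
open import Data.List.Relation.Unary.All using (All; []; _∷_; head)
open import Data.Product using (Σ; _×_; _,_; proj₁)
open import Data.Empty using (⊥-elim)
open import Function.Base using (_∘_)
open import Relation.Nullary using (yes; no)
open import Relation.Binary.PropositionalEquality hiding ([_])

δ : ℕ → ℕ → ℕ
δ zero    zero    = 1
δ zero    (suc _) = 0
δ (suc _) zero    = 0
δ (suc m) (suc n) = δ m n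

δ-refl : ∀ m → δ m m ≡ 1
δ-refl zero    = refl
δ-refl (suc m) = δ-refl m

δ-≢ : ∀ {m n} → m ≢ n → δ m n ≡ 0
δ-≢ {zero}  {zero}  m≢n = ⊥-elim (m≢n refl)
δ-≢ {zero}  {suc n} m≢n = refl
δ-≢ {suc m} {zero}  m≢n = refl
δ-≢ {suc m} {suc n} m≢n = δ-≢ (m≢n ∘ cong suc)

δ≢0⇒≡ : ∀ {m n} → δ m n ≢ 0 → m ≡ n
δ≢0⇒≡ {m} {n} δ≢0 with m ≟ n
... | yes m≡n = m≡n
... | no  m≢n = ⊥-elim (δ≢0 (δ-≢ m≢n))

δ-≤1 : ∀ m n → δ m n ≤ 1
δ-≤1 zero    zero    = ≤-refl
δ-≤1 zero    (suc n) = z≤n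
δ-≤1 (suc m) zero    = z≤n
δ-≤1 (suc m) (suc n) = δ-≤1 m n

δ-sym : ∀ m n → δ m n ≡ δ n m
δ-sym zero    zero    = refl
δ-sym zero    (suc n) = refl
δ-sym (suc m) zero    = refl
δ-sym (suc m) (suc n) = δ-sym m n

χ< : ℕ → ℕ → ℕ
χ< _       zero    = 0
χ< zero    (suc _) = 1
χ< (suc m) (suc n) = χ< m n

χ<-< : ∀ {m n} → m < n → χ< m n ≡ 1
χ<-< {zero}  {suc n} _         = refl
χ<-< {suc m} {suc n} (s≤s m<n) = χ<-< m<n

χ<-≥ : ∀ {m n} → n ≤ m → χ< m n ≡ 0
χ<-≥ {m}     {zero}  _         = refl
χ<-≥ {suc m} {suc n} (s≤s n≤m) = χ<-≥ n≤m

χ<-≤1 : ∀ m n → χ< m n ≤ 1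
χ<-≤1 m       zero    = z≤n
χ<-≤1 zero    (suc n) = ≤-refl
χ<-≤1 (suc m) (suc n) = χ<-≤1 m n

χ<-mono : ∀ {m m′ n n′} → m′ ≤ m → n ≤ n′ → χ< m n ≤ χ< m′ n′
χ<-mono {m} {n = n} m′≤m n≤n′ with m <? n
... | yes m<n = subst (χ< m n ≤_) (sym (χ<-< (≤-<-trans m′≤m (<-≤-trans m<n n≤n′)))) (χ<-≤1 m n)
... | no  m≮n = subst (_≤ _) (sym (χ<-≥ (≮⇒≥ m≮n))) z≤n

*≢0⇒≢0×≢0 : ∀ {m n} → m * n ≢ 0 → m ≢ 0 × n ≢ 0
*≢0⇒≢0×≢0 {m} {n} mn≢0 =
  (λ m≡0 → mn≢0 (cong (_* n) m≡0)) , (λ n≡0 → mn≢0 (trans (cong (m *_) n≡0) (*-zeroʳ m)))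

isBp-≤1 : ∀ p → isBp p ≤ 1
isBp-≤1 (x , y) with y ≟ suc x
... | yes _ = z≤n
... | no  _ = ≤-refl

isGap-≤1 : ∀ p → isGap p ≤ 1
isGap-≤1 (x , y) with y ≟ suc x | y <? x
... | yes _ | _     = z≤n
... | no  _ | yes _ = z≤n
... | no  _ | no  _ = ≤-refl

isDes≡χ< : ∀ x y → isDes (x , y) ≡ χ< y x
isDes≡χ< x y with y ≟ suc x | y <? x
... | yes refl | _     = sym (χ<-≥ (n≤1+n x))
... | no  _    | yes p = sym (χ<-< p)
... | no  _    | no ¬p = sym (χ<-≥ (≮⇒≥ ¬p))

isGap-descent : ∀ {x y} → y < x → isGap (x , y) ≡ 0
isGap-descent {x} {y} y<x with y ≟ suc x | y <? x
... | yes _ | _     = refl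
... | no  _ | yes _ = refl
... | no  _ | no ¬p = ⊥-elim (¬p y<x)

isGap≡χ<∸δ : ∀ x y → x ≢ y → isGap (x , y) ≡ χ< x y ∸ δ (suc x) y
isGap≡χ<∸δ x y x≢y with y ≟ suc x | y <? x
... | yes refl | _     = sym (cong₂ _∸_ (χ<-< (n<1+n x)) (δ-refl (suc x)))
... | no  _    | yes p = sym (trans (cong (_∸ δ (suc x) y) (χ<-≥ (<⇒≤ p))) (0∸n≡0 (δ (suc x) y)))
... | no  y≢1+x | no ¬p =
  sym (cong₂ _∸_ (χ<-< (≤∧≢⇒< (≮⇒≥ ¬p) x≢y)) (δ-≢ (y≢1+x ∘ sym)))

isBp-succ : ∀ v → isBp (v , suc v) ≡ 0
isBp-succ v with suc v ≟ suc v
... | yes _ = refl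
... | no ne = ⊥-elim (ne refl)

isDes-succ : ∀ v → isDes (v , suc v) ≡ 0
isDes-succ v = trans (isDes≡χ< v (suc v)) (χ<-≥ (n≤1+n v))

isGap-succ : ∀ v → isGap (v , suc v) ≡ 0
isGap-succ v with suc v ≟ suc v | suc v <? v
... | yes _ | _ = refl
... | no ne | _ = ⊥-elim (ne refl)

sumBelow : (ℕ → ℕ) → ℕ → ℕ
sumBelow f zero    = 0
sumBelow f (suc N) = sumBelow f N + f N

sumBelow-cong : ∀ {f g} N → (∀ v → v < N → f v ≡ g v) → sumBelow f N ≡ sumBelow g N
sumBelow-cong zero    f≡g = refl
sumBelow-cong (suc N) f≡g = cong₂ _+_ (sumBelow-cong N (λ v v<N → f≡g v (m<n⇒m<1+n v<N))) (f≡g N (n<1+n N))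

sumBelow-zero : ∀ {f} N → (∀ v → v < N → f v ≡ 0) → sumBelow f N ≡ 0
sumBelow-zero zero    f≡0 = refl
sumBelow-zero (suc N) f≡0 = cong₂ _+_ (sumBelow-zero N (λ v v<N → f≡0 v (m<n⇒m<1+n v<N))) (f≡0 N (n<1+n N))

sumBelow-mono : ∀ {f g} N → (∀ v → f v ≤ g v) → sumBelow f N ≤ sumBelow g N
sumBelow-mono zero    f≤g = z≤n
sumBelow-mono (suc N) f≤g = +-mono-≤ (sumBelow-mono N f≤g) (f≤g N)

sumBelow-+ : ∀ f g N → sumBelow (λ v → f v + g v) N ≡ sumBelow f N + sumBelow g N
sumBelow-+ f g zero    = refl
sumBelow-+ f g (suc N) = trans (cong (_+ (f N + g N)) (sumBelow-+ f g N)) (interchange (sumBelow f N) (sumBelow g N) (f N) (g N))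
  where
  interchange : ∀ a b c d → a + b + (c + d) ≡ a + c + (b + d)
  interchange = solve-∀

sumBelow-≤-+ : ∀ {f g h} N → (∀ v → f v ≤ g v + h v) → sumBelow f N ≤ sumBelow g N + sumBelow h N
sumBelow-≤-+ {f} {g} {h} N f≤g+h = ≤-trans (sumBelow-mono N f≤g+h) (≤-reflexive (sumBelow-+ g h N))

sumBelow-suc : ∀ f M → sumBelow f (suc M) ≡ f 0 + sumBelow (f ∘ suc) M
sumBelow-suc f zero    = +-comm 0 (f 0)
sumBelow-suc f (suc M) = trans (cong (_+ f (suc M)) (sumBelow-suc f M)) (+-assoc (f 0) _ _)

sumBelow-≤1 : ∀ {f} N → (∀ v → f v ≤ 1) → (∀ {v w} → f v ≢ 0 → f w ≢ 0 → v ≡ w) → sumBelow f N ≤ 1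
sumBelow-≤1         zero    f≤1 unique = z≤n
sumBelow-≤1 {f = f} (suc N) f≤1 unique with f N ≟ 0
... | yes fN≡0 = subst (_≤ 1) (sym (trans (cong (sumBelow f N +_) fN≡0) (+-identityʳ _))) (sumBelow-≤1 N f≤1 unique)
... | no  fN≢0 = subst (_≤ 1) (sym (cong (_+ f N) (sumBelow-zero N below))) (f≤1 N)
  where
  below : ∀ v → v < N → f v ≡ 0
  below v v<N with f v ≟ 0
  ... | yes fv≡0 = fv≡0
  ... | no  fv≢0 = ⊥-elim (<-irrefl (unique fv≢0 fN≢0) v<N)

occ : ℕ → List ℕ → ℕ
occ a []      = 0
occ a (x ∷ w) = δ a x + occ a w

before : ℕ → ℕ → List ℕ → ℕ
before a b []      = 0
before a b (x ∷ w) = δ a x * occ b w + before a b w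

adjSum : (ℕ × ℕ → ℕ) → List ℕ → ℕ
adjSum h w = sum (map h (adjPairs w))

pairIs : ℕ → ℕ → ℕ × ℕ → ℕ
pairIs a b (x , y) = δ a x * δ b y

adjacent : ℕ → ℕ → List ℕ → ℕ
adjacent a b = adjSum (pairIs a b)

lastOf : ℕ → List ℕ → ℕ
lastOf x []       = x
lastOf x (y ∷ ys) = lastOf y ys

Distinct : List ℕ → Set
Distinct w = ∀ a → occ a w ≤ 1

occ≢0⇒All : ∀ {P : ℕ → Set} {a} X → occ a X ≢ 0 → All P X → P a
occ≢0⇒All         []      occ≢0 []         = ⊥-elim (occ≢0 refl)
occ≢0⇒All {a = a} (x ∷ X) occ≢0 (px ∷ pX) with a ≟ x
... | yes refl = px
... | no  a≢x  = occ≢0⇒All X (λ occ≡0 → occ≢0 (cong₂ _+_ (δ-≢ a≢x) occ≡0)) pX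

All-last : ∀ {P : ℕ → Set} x xs → All P (x ∷ xs) → P (lastOf x xs)
All-last x []       (px ∷ _)  = px
All-last x (y ∷ ys) (_  ∷ ps) = All-last y ys ps

δ-last≤occ : ∀ a x xs → δ a (lastOf x xs) ≤ occ a (x ∷ xs)
δ-last≤occ a x []       = m≤m+n (δ a x) 0
δ-last≤occ a x (y ∷ ys) = ≤-trans (δ-last≤occ a y ys) (m≤n+m _ (δ a x))

occ-++ : ∀ a X Y → occ a (X ++ Y) ≡ occ a X + occ a Y
occ-++ a []      Y = refl
occ-++ a (x ∷ X) Y = trans (cong (δ a x +_) (occ-++ a X Y)) (sym (+-assoc (δ a x) _ _))

before-++ : ∀ a b X Y → before a b (X ++ Y) ≡ before a b X + before a b Y + occ a X * occ b Y
before-++ a b []      Y = sym (+-identityʳ _)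
before-++ a b (x ∷ X) Y rewrite occ-++ b X Y | before-++ a b X Y =
  distrib (δ a x) (occ b X) (occ b Y) (before a b X) (before a b Y) (occ a X)
  where
  distrib : ∀ e cX cY pX pY aX → e * (cX + cY) + (pX + pY + aX * cY) ≡ e * cX + pX + pY + (e + aX) * cY
  distrib = solve-∀

adjSum-++ : ∀ h x xs y ys → adjSum h ((x ∷ xs) ++ (y ∷ ys)) ≡ adjSum h (x ∷ xs) + h (lastOf x xs , y) + adjSum h (y ∷ ys)
adjSum-++ h x []       y ys = refl
adjSum-++ h x (z ∷ zs) y ys = trans (cong (h (x , z) +_) (adjSum-++ h z zs y ys)) (reassoc (h (x , z)) _ _ _)
  where
  reassoc : ∀ p q r s → p + (q + r + s) ≡ p + q + r + s
  reassoc = solve-∀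

occ-++ˡ : ∀ a X Y → occ a X ≤ occ a (X ++ Y)
occ-++ˡ a X Y = subst (occ a X ≤_) (sym (occ-++ a X Y)) (m≤m+n _ _)

occ-++ʳ : ∀ a X Y → occ a Y ≤ occ a (X ++ Y)
occ-++ʳ a X Y = subst (occ a Y ≤_) (sym (occ-++ a X Y)) (m≤n+m _ _)

occ-swap : ∀ a X₁ X₂ X₃ X₄ → occ a (X₁ ++ X₃ ++ X₂ ++ X₄) ≡ occ a (X₁ ++ X₂ ++ X₃ ++ X₄)
occ-swap a X₁ X₂ X₃ X₄
  rewrite occ-++ a X₁ (X₃ ++ X₂ ++ X₄) | occ-++ a X₃ (X₂ ++ X₄) | occ-++ a X₂ X₄
        | occ-++ a X₁ (X₂ ++ X₃ ++ X₄) | occ-++ a X₂ (X₃ ++ X₄) | occ-++ a X₃ X₄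
  = exchange (occ a X₁) (occ a X₃) (occ a X₂) (occ a X₄)
  where
  exchange : ∀ p q r s → p + (q + (r + s)) ≡ p + (r + (q + s))
  exchange = solve-∀

before-swap : ∀ a b X₁ X₂ X₃ X₄ →
  before a b (X₁ ++ X₂ ++ X₃ ++ X₄) + occ a X₃ * occ b X₂ ≡
  before a b (X₁ ++ X₃ ++ X₂ ++ X₄) + occ a X₂ * occ b X₃
before-swap a b X₁ X₂ X₃ X₄
  rewrite before-++ a b X₁ (X₂ ++ X₃ ++ X₄) | before-++ a b X₂ (X₃ ++ X₄) | before-++ a b X₃ X₄
        | before-++ a b X₁ (X₃ ++ X₂ ++ X₄) | before-++ a b X₃ (X₂ ++ X₄) | before-++ a b X₂ X₄
        | occ-++ b X₂ (X₃ ++ X₄) | occ-++ b X₃ X₄ | occ-++ b X₃ (X₂ ++ X₄) | occ-++ b X₂ X₄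
  = exchange (before a b X₁) (before a b X₂) (before a b X₃) (before a b X₄)
             (occ a X₁) (occ a X₂) (occ a X₃) (occ b X₂) (occ b X₃) (occ b X₄)
  where
  exchange : ∀ p₁ p₂ p₃ p₄ a₁ a₂ a₃ b₂ b₃ b₄ →
    p₁ + (p₂ + (p₃ + p₄ + a₃ * b₄) + a₂ * (b₃ + b₄)) + a₁ * (b₂ + (b₃ + b₄)) + a₃ * b₂ ≡
    p₁ + (p₃ + (p₂ + p₄ + a₂ * b₄) + a₃ * (b₂ + b₄)) + a₁ * (b₃ + (b₂ + b₄)) + a₂ * b₃
  exchange = solve-∀

-- Monotone block moves

-- The nonempty blocks around a block move in an extended word: x ∷ xs precedes the move
-- and d ∷ D follows it, which is where π₀ = 0 and πₙ₊₁ = n+1 are used.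
record MoveSite : Set where
  field
    x : ℕ
    xs : List ℕ
    b : ℕ
    B : List ℕ
    c : ℕ
    C : List ℕ
    d : ℕ
    D : List ℕ

  src tgt : List ℕ
  src = (x ∷ xs) ++ (b ∷ B) ++ (c ∷ C) ++ (d ∷ D)
  tgt = (x ∷ xs) ++ (c ∷ C) ++ (b ∷ B) ++ (d ∷ D)

  x′ b′ c′ : ℕ
  x′ = lastOf x xs
  b′ = lastOf b B
  c′ = lastOf c C

  Monotone : Set
  Monotone = All (λ y → All (_< y) (c ∷ C)) (b ∷ B)

DropsBy : (List ℕ → ℕ) → ℕ → Set
DropsBy Φ k = ∀ s → let open MoveSite s in Monotone → Distinct src → Φ src ≤ Φ tgt + k

adjSum-++⁴ : ∀ h x xs b B c C d D →
  adjSum h ((x ∷ xs) ++ (b ∷ B) ++ (c ∷ C) ++ (d ∷ D)) ≡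
  adjSum h (x ∷ xs) + h (lastOf x xs , b) +
    (adjSum h (b ∷ B) + h (lastOf b B , c) + (adjSum h (c ∷ C) + h (lastOf c C , d) + adjSum h (d ∷ D)))
adjSum-++⁴ h x xs b B c C d D = begin
  adjSum h ((x ∷ xs) ++ (b ∷ B) ++ (c ∷ C) ++ (d ∷ D))
    ≡⟨ adjSum-++ h x xs b (B ++ (c ∷ C) ++ (d ∷ D)) ⟩
  adjSum h (x ∷ xs) + h (lastOf x xs , b) + adjSum h ((b ∷ B) ++ (c ∷ C) ++ (d ∷ D))
    ≡⟨ cong (adjSum h (x ∷ xs) + h (lastOf x xs , b) +_) (adjSum-++ h b B c (C ++ (d ∷ D))) ⟩
  adjSum h (x ∷ xs) + h (lastOf x xs , b) + (adjSum h (b ∷ B) + h (lastOf b B , c) + adjSum h ((c ∷ C) ++ (d ∷ D)))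
    ≡⟨ cong (λ t → adjSum h (x ∷ xs) + h (lastOf x xs , b) + (adjSum h (b ∷ B) + h (lastOf b B , c) + t))
            (adjSum-++ h c C d D) ⟩
  adjSum h (x ∷ xs) + h (lastOf x xs , b) +
    (adjSum h (b ∷ B) + h (lastOf b B , c) + (adjSum h (c ∷ C) + h (lastOf c C , d) + adjSum h (d ∷ D)))
    ∎
  where open ≡-Reasoning

module _ (h : ℕ × ℕ → ℕ) (s : MoveSite) where
  open MoveSite s

  -- Both sides are the sum over the four blocks plus all six boundary adjacencies.
  adjSum-swap : adjSum h src + (h (x′ , c) + h (b′ , d) + h (c′ , b)) ≡
                adjSum h tgt + (h (x′ , b) + h (b′ , c) + h (c′ , d))
  adjSum-swap rewrite adjSum-++⁴ h x xs b B c C d D | adjSum-++⁴ h x xs c C b B d D =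
    exchange (adjSum h (x ∷ xs)) (adjSum h (b ∷ B)) (adjSum h (c ∷ C)) (adjSum h (d ∷ D))
             (h (x′ , b)) (h (b′ , c)) (h (c′ , d)) (h (x′ , c)) (h (b′ , d)) (h (c′ , b))
    where
    exchange : ∀ a₁ a₂ a₃ a₄ u₁ u₂ u₃ v₁ v₂ v₃ →
      a₁ + u₁ + (a₂ + u₂ + (a₃ + u₃ + a₄)) + (v₁ + v₂ + v₃) ≡
      a₁ + v₁ + (a₃ + v₃ + (a₂ + v₂ + a₄)) + (u₁ + u₂ + u₃)
    exchange = solve-∀

  adjSum-drop : ∀ {k₁ k₂ k₃} →
    h (x′ , b) ≤ h (x′ , c) + k₁ → h (b′ , c) ≤ k₂ → h (c′ , d) ≤ h (b′ , d) + k₃ →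
    adjSum h src ≤ adjSum h tgt + (k₁ + k₂ + k₃)
  adjSum-drop {k₁} {k₂} {k₃} first middle last =
    +-cancelʳ-≤ (h (x′ , c) + h (b′ , d) + h (c′ , b)) (adjSum h src) (adjSum h tgt + (k₁ + k₂ + k₃)) (begin
      adjSum h src + (h (x′ , c) + h (b′ , d) + h (c′ , b))
        ≡⟨ adjSum-swap ⟩
      adjSum h tgt + (h (x′ , b) + h (b′ , c) + h (c′ , d))
        ≤⟨ +-monoʳ-≤ (adjSum h tgt) (+-mono-≤ (+-mono-≤ first middle) last) ⟩
      adjSum h tgt + (h (x′ , c) + k₁ + k₂ + (h (b′ , d) + k₃))
        ≤⟨ +-monoʳ-≤ (adjSum h tgt) (m≤m+n _ (h (c′ , b))) ⟩
      adjSum h tgt + (h (x′ , c) + k₁ + k₂ + (h (b′ , d) + k₃) + h (c′ , b))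
        ≡⟨ exchange (adjSum h tgt) (h (x′ , c)) (h (b′ , d)) (h (c′ , b)) k₁ k₂ k₃ ⟩
      adjSum h tgt + (k₁ + k₂ + k₃) + (h (x′ , c) + h (b′ , d) + h (c′ , b))
        ∎)
    where
    open ≤-Reasoning
    exchange : ∀ t q₁ q₂ q₃ k₁ k₂ k₃ →
      t + (q₁ + k₁ + k₂ + (q₂ + k₃) + q₃) ≡ t + (k₁ + k₂ + k₃) + (q₁ + q₂ + q₃)
    exchange = solve-∀

bp-drop : DropsBy countBp 3
bp-drop s _ _ = adjSum-drop isBp s
  (≤-trans (isBp-≤1 _) (m≤n+m 1 _)) (isBp-≤1 _) (≤-trans (isBp-≤1 _) (m≤n+m 1 _))

gap-drop : DropsBy countGap 2
gap-drop s mono _ = adjSum-drop isGap s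
  (≤-trans (isGap-≤1 _) (m≤n+m 1 _))
  (≤-reflexive (isGap-descent (head (All-last b B mono))))
  (≤-trans (isGap-≤1 _) (m≤n+m 1 _))
  where open MoveSite s

des-drop : DropsBy countDes 1
des-drop s mono _ = adjSum-drop isDes s
  (subst₂ (λ p q → p ≤ q + 0) (sym (isDes≡χ< x′ b)) (sym (isDes≡χ< x′ c))
    (≤-trans (χ<-mono {n = x′} (<⇒≤ c<b) ≤-refl) (m≤m+n _ 0)))
  (subst (_≤ 1) (sym (isDes≡χ< b′ c)) (χ<-≤1 c b′))
  (subst₂ (λ p q → p ≤ q + 0) (sym (isDes≡χ< c′ d)) (sym (isDes≡χ< b′ d))
    (≤-trans (χ<-mono {m = d} ≤-refl (<⇒≤ c′<b′)) (m≤m+n _ 0)))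
  where
  open MoveSite s
  c<b : c < b
  c<b = head (head mono)
  c′<b′ : c′ < b′
  c′<b′ = All-last c C (All-last b B mono)

pairIs-≤1 : ∀ a b p → pairIs a b p ≤ 1
pairIs-≤1 a b (x , y) = *-mono-≤ (δ-≤1 a x) (δ-≤1 b y)

pairIs≢0⇒≡ : ∀ a b x y → pairIs a b (x , y) ≢ 0 → a ≡ x
pairIs≢0⇒≡ a b x y = δ≢0⇒≡ ∘ proj₁ ∘ *≢0⇒≢0×≢0 {δ a x} {δ b y}

∸-≤-∸ : ∀ {p q r K e z} → r ≤ q + (e + z) → z ≤ K → p ∸ q ≤ p + K ∸ r + e
∸-≤-∸ {p} {q} {r} {K} {e} {z} r≤ z≤K = m≤n+o⇒m∸n≤o p q (+-cancelʳ-≤ K p _ (begin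
  p + K                 ≤⟨ m≤n+m∸n (p + K) r ⟩
  r + t                 ≤⟨ +-monoˡ-≤ t r≤ ⟩
  q + (e + z) + t       ≡⟨ exchange q e z t ⟩
  q + (t + e) + z       ≤⟨ +-monoʳ-≤ (q + (t + e)) z≤K ⟩
  q + (t + e) + K       ∎))
  where
  open ≤-Reasoning
  t = p + K ∸ r
  exchange : ∀ q e z t → q + (e + z) + t ≡ q + (t + e) + z
  exchange = solve-∀

-- des⁻¹ (n+1) and gap⁻¹ (n+1) compute the descents and gaps of π⁻¹ from the extended word of π.
des⁻¹ gap⁻¹ : ℕ → List ℕ → ℕ
des⁻¹ N w = sumBelow (λ v → before (suc v) v w) N
gap⁻¹ N w = sumBelow (λ v → before v (suc v) w ∸ adjacent v (suc v) w) N

des⁻¹-drop : ∀ N → DropsBy (des⁻¹ N) 1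
des⁻¹-drop N s mono distinct =
  ≤-trans (sumBelow-≤-+ N pointwise) (+-monoʳ-≤ (des⁻¹ N tgt) (sumBelow-≤1 N crossing-≤1 crossing-unique))
  where
  open MoveSite s
  crossing : ℕ → ℕ
  crossing v = occ (suc v) (b ∷ B) * occ v (c ∷ C)
  pointwise : ∀ v → before (suc v) v src ≤ before (suc v) v tgt + crossing v
  pointwise v = ≤-trans (m≤m+n _ _) (≤-reflexive (before-swap (suc v) v (x ∷ xs) (b ∷ B) (c ∷ C) (d ∷ D)))
  crossing-≤1 : ∀ v → crossing v ≤ 1
  crossing-≤1 v = *-mono-≤
    (≤-trans (≤-trans (occ-++ˡ (suc v) (b ∷ B) _) (occ-++ʳ (suc v) (x ∷ xs) _)) (distinct (suc v)))
    (≤-trans (≤-trans (occ-++ˡ v (c ∷ C) _) (≤-trans (occ-++ʳ v (b ∷ B) _) (occ-++ʳ v (x ∷ xs) _))) (distinct v))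
  below : ∀ {v w} → occ (suc v) (b ∷ B) ≢ 0 → occ w (c ∷ C) ≢ 0 → w < suc v
  below {v} {w} v+1∈B w∈C = occ≢0⇒All (c ∷ C) w∈C (occ≢0⇒All (b ∷ B) v+1∈B mono)
  crossing-unique : ∀ {v w} → crossing v ≢ 0 → crossing w ≢ 0 → v ≡ w
  crossing-unique {v} {w} cv≢0 cw≢0
    with *≢0⇒≢0×≢0 {occ (suc v) (b ∷ B)} {occ v (c ∷ C)} cv≢0
       | *≢0⇒≢0×≢0 {occ (suc w) (b ∷ B)} {occ w (c ∷ C)} cw≢0
  ... | v+1∈B , v∈C | w+1∈B , w∈C = ≤-antisym (s≤s⁻¹ (below w+1∈B v∈C)) (s≤s⁻¹ (below v+1∈B w∈C))

gap⁻¹-drop : ∀ N → DropsBy (gap⁻¹ N) 2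
gap⁻¹-drop N s mono _ =
  ≤-trans (sumBelow-≤-+ N pointwise)
    (+-monoʳ-≤ (gap⁻¹ N tgt) (≤-trans (≤-reflexive (sumBelow-+ created₁ created₂ N))
      (+-mono-≤ (sumBelow-≤1 N (λ v → pairIs-≤1 v (suc v) (x′ , c)) (unique x′ c))
                (sumBelow-≤1 N (λ v → pairIs-≤1 v (suc v) (b′ , d)) (unique b′ d)))))
  where
  open MoveSite s
  created₁ created₂ : ℕ → ℕ
  created₁ v = pairIs v (suc v) (x′ , c)
  created₂ v = pairIs v (suc v) (b′ , d)
  unique : ∀ y z {v w} → pairIs v (suc v) (y , z) ≢ 0 → pairIs w (suc w) (y , z) ≢ 0 → v ≡ w
  unique y z {v} {w} p q = trans (pairIs≢0⇒≡ v (suc v) y z p) (sym (pairIs≢0⇒≡ w (suc w) y z q))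
  no-ascent-crossing : ∀ v → occ v (b ∷ B) * occ (suc v) (c ∷ C) ≡ 0
  no-ascent-crossing v with occ v (b ∷ B) ≟ 0 | occ (suc v) (c ∷ C) ≟ 0
  ... | yes v∉B | _         = cong (_* occ (suc v) (c ∷ C)) v∉B
  ... | no  _   | yes v+1∉C = trans (cong (occ v (b ∷ B) *_) v+1∉C) (*-zeroʳ (occ v (b ∷ B)))
  ... | no  v∈B | no  v+1∈C = ⊥-elim (<-asym (n<1+n v) (occ≢0⇒All (c ∷ C) v+1∈C (occ≢0⇒All (b ∷ B) v∈B mono)))
  -- The move creates occ v (c ∷ C) · occ (v+1) (b ∷ B) new occurrences of v before v+1 and at
  -- most three new adjacencies v, v+1, of which the one at (c′ , b) is such an occurrence.
  pointwise : ∀ v → before v (suc v) src ∸ adjacent v (suc v) src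
                  ≤ before v (suc v) tgt ∸ adjacent v (suc v) tgt + (created₁ v + created₂ v)
  pointwise v =
    subst (λ t → before v (suc v) src ∸ adjacent v (suc v) src ≤ t ∸ adjacent v (suc v) tgt + (created₁ v + created₂ v))
      before-tgt
      (∸-≤-∸ {q = adjacent v (suc v) src} {e = created₁ v + created₂ v} adjacent-tgt
        (*-mono-≤ (δ-last≤occ v c C) (m≤m+n (δ (suc v) b) (occ (suc v) B))))
    where
    before-tgt : before v (suc v) src + occ v (c ∷ C) * occ (suc v) (b ∷ B) ≡ before v (suc v) tgt
    before-tgt = trans (before-swap v (suc v) (x ∷ xs) (b ∷ B) (c ∷ C) (d ∷ D))
                       (trans (cong (before v (suc v) tgt +_) (no-ascent-crossing v)) (+-identityʳ _))
    adjacent-tgt : adjacent v (suc v) tgt ≤ adjacent v (suc v) src + (created₁ v + created₂ v + pairIs v (suc v) (c′ , b))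
    adjacent-tgt = ≤-trans (m≤m+n _ _) (≤-reflexive (sym (adjSum-swap (pairIs v (suc v)) s)))

∷ʳ-view : ∀ (D : List ℕ) z → Σ ℕ λ d → Σ (List ℕ) λ D′ → D ++ [ z ] ≡ d ∷ D′
∷ʳ-view []      z = z , [] , refl
∷ʳ-view (y ∷ D) z = y , D ++ [ z ] , refl

site-of-move : ∀ n {w w′} → MonoMove w w′ →
  Σ MoveSite λ s → let open MoveSite s in Monotone × extend n w ≡ src × extend n w′ ≡ tgt
site-of-move n (move A b B c C D mono) with ∷ʳ-view D (suc n)
... | d , D′ , D∷ʳ≡ = site , mono , extended (b ∷ B) (c ∷ C) , extended (c ∷ C) (b ∷ B)
  where
  site : MoveSite
  site = record { x = 0 ; xs = A ; b = b ; B = B ; c = c ; C = C ; d = d ; D = D′ }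
  extended : ∀ X Y → extend n (A ++ X ++ Y ++ D) ≡ (0 ∷ A) ++ X ++ Y ++ (d ∷ D′)
  extended X Y = cong (0 ∷_) (begin
    (A ++ X ++ Y ++ D) ++ [ suc n ]  ≡⟨ ++-assoc A (X ++ Y ++ D) [ suc n ] ⟩
    A ++ (X ++ Y ++ D) ++ [ suc n ]  ≡⟨ cong (A ++_) (++-assoc X (Y ++ D) [ suc n ]) ⟩
    A ++ X ++ (Y ++ D) ++ [ suc n ]  ≡⟨ cong (λ t → A ++ X ++ t) (++-assoc Y D [ suc n ]) ⟩
    A ++ X ++ Y ++ D ++ [ suc n ]    ≡⟨ cong (λ t → A ++ X ++ Y ++ t) D∷ʳ≡ ⟩
    A ++ X ++ Y ++ (d ∷ D′)          ∎)
    where open ≡-Reasoning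

module _ {Φ : List ℕ → ℕ} {k : ℕ} (drops : DropsBy Φ k) (n : ℕ) where

  drop-move : ∀ {w w′} → MonoMove w w′ → Distinct (extend n w) → Φ (extend n w) ≤ Φ (extend n w′) + k
  drop-move mv distinct with site-of-move n mv
  ... | s , mono , w≡src , w′≡tgt =
    subst₂ (λ u u′ → Φ u ≤ Φ u′ + k) (sym w≡src) (sym w′≡tgt) (drops s mono (subst Distinct w≡src distinct))

  distinct-move : ∀ {w w′} → MonoMove w w′ → Distinct (extend n w) → Distinct (extend n w′)
  distinct-move {w} {w′} mv distinct a with site-of-move n mv
  ... | s , _ , w≡src , w′≡tgt = begin
    occ a (extend n w′) ≡⟨ cong (occ a) w′≡tgt ⟩
    occ a tgt           ≡⟨ occ-swap a (x ∷ xs) (b ∷ B) (c ∷ C) (d ∷ D) ⟩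
    occ a src           ≡⟨ cong (occ a) (sym w≡src) ⟩
    occ a (extend n w)  ≤⟨ distinct a ⟩
    1                   ∎
    where
    open MoveSite s
    open ≤-Reasoning

  drop-moves : ∀ {m w w′} → MonoMoves m w w′ → Distinct (extend n w) → Φ (extend n w) ≤ Φ (extend n w′) + k * m
  drop-moves done _ = m≤m+n _ _
  drop-moves {suc m} {w} {w″} (step {w' = w′} mv mvs) distinct = begin
    Φ (extend n w)               ≤⟨ drop-move mv distinct ⟩
    Φ (extend n w′) + k          ≤⟨ +-monoˡ-≤ k (drop-moves mvs (distinct-move mv distinct)) ⟩
    Φ (extend n w″) + k * m + k  ≡⟨ +-assoc (Φ (extend n w″)) (k * m) k ⟩
    Φ (extend n w″) + (k * m + k) ≡⟨ cong (Φ (extend n w″) +_) (trans (+-comm (k * m) k) (sym (*-suc k m))) ⟩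
    Φ (extend n w″) + k * suc m  ∎
    where open ≤-Reasoning

-- Words listing an injective function

before-absentˡ : ∀ a b w → occ a w ≡ 0 → before a b w ≡ 0
before-absentˡ a b []      _      = refl
before-absentˡ a b (x ∷ w) a∉x∷w =
  cong₂ _+_ (cong (_* occ b w) (m+n≡0⇒m≡0 (δ a x) a∉x∷w)) (before-absentˡ a b w (m+n≡0⇒n≡0 (δ a x) a∉x∷w))

before-absentʳ : ∀ a b w → occ b w ≡ 0 → before a b w ≡ 0
before-absentʳ a b []      _      = refl
before-absentʳ a b (x ∷ w) b∉x∷w =
  cong₂ _+_ (trans (cong (δ a x *_) b∉w) (*-zeroʳ (δ a x))) (before-absentʳ a b w b∉w)
  where
  b∉w : occ b w ≡ 0
  b∉w = m+n≡0⇒n≡0 (δ b x) b∉x∷w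

adjacent-absentˡ : ∀ a b w → occ a w ≡ 0 → adjacent a b w ≡ 0
adjacent-absentˡ a b []          _      = refl
adjacent-absentˡ a b (x ∷ [])    _      = refl
adjacent-absentˡ a b (x ∷ y ∷ w) a∉x∷w =
  cong₂ _+_ (cong (_* δ b y) (m+n≡0⇒m≡0 (δ a x) a∉x∷w))
            (adjacent-absentˡ a b (y ∷ w) (m+n≡0⇒n≡0 (δ a x) a∉x∷w))

adjacent-absentʳ : ∀ a b w → occ b w ≡ 0 → adjacent a b w ≡ 0
adjacent-absentʳ a b []          _      = refl
adjacent-absentʳ a b (x ∷ [])    _      = refl
adjacent-absentʳ a b (x ∷ y ∷ w) b∉x∷w =
  cong₂ _+_ (trans (cong (δ a x *_) (m+n≡0⇒m≡0 (δ b y) b∉y∷w)) (*-zeroʳ (δ a x)))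
            (adjacent-absentʳ a b (y ∷ w) b∉y∷w)
  where
  b∉y∷w : occ b (y ∷ w) ≡ 0
  b∉y∷w = m+n≡0⇒n≡0 (δ b x) b∉x∷w

InjectiveBelow : (ℕ → ℕ) → ℕ → Set
InjectiveBelow E M = ∀ {i j} → i < M → j < M → E i ≡ E j → i ≡ j

module _ {E : ℕ → ℕ} {M : ℕ} (injective : InjectiveBelow E (suc M)) where

  injective-suc : InjectiveBelow (E ∘ suc) M
  injective-suc i<M j<M Ei≡Ej = suc-injective (injective (s≤s i<M) (s≤s j<M) Ei≡Ej)

  head-unique : ∀ {k} → k < M → E (suc k) ≢ E 0
  head-unique k<M E1+k≡E0 with injective (s≤s k<M) (s≤s z≤n) E1+k≡E0
  ... | ()

  head-∉-tail : occ (E 0) (applyUpTo (E ∘ suc) M) ≡ 0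
  head-∉-tail = absent M head-unique
    where
    absent : ∀ {a} {F : ℕ → ℕ} L → (∀ {k} → k < L → F k ≢ a) → occ a (applyUpTo F L) ≡ 0
    absent zero    F≢a = refl
    absent (suc L) F≢a = cong₂ _+_ (δ-≢ (F≢a z<s ∘ sym)) (absent L (F≢a ∘ s≤s))

occ-applyUpTo : ∀ E M {i} → InjectiveBelow E M → i < M → occ (E i) (applyUpTo E M) ≡ 1
occ-applyUpTo E (suc M) {zero}  injective _         = cong₂ _+_ (δ-refl (E 0)) (head-∉-tail injective)
occ-applyUpTo E (suc M) {suc i} injective (s≤s i<M) =
  cong₂ _+_ (δ-≢ (head-unique injective i<M)) (occ-applyUpTo (E ∘ suc) M (injective-suc injective) i<M)

distinct-applyUpTo : ∀ E M → InjectiveBelow E M → Distinct (applyUpTo E M)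
distinct-applyUpTo E zero    injective a = z≤n
distinct-applyUpTo E (suc M) injective a with a ≟ E 0
... | yes refl = ≤-reflexive (cong₂ _+_ (δ-refl (E 0)) (head-∉-tail injective))
... | no  a≢E0 = subst (_≤ 1) (sym (cong (_+ occ a (applyUpTo (E ∘ suc) M)) (δ-≢ a≢E0)))
                   (distinct-applyUpTo (E ∘ suc) M (injective-suc injective) a)

δ-applyUpTo : ∀ E M {i k} → InjectiveBelow E M → i < M → k < M → δ (E i) (E k) ≡ δ i k
δ-applyUpTo E M {i} {k} injective i<M k<M with i ≟ k
... | yes refl = trans (δ-refl (E i)) (sym (δ-refl i))
... | no  i≢k  = trans (δ-≢ (i≢k ∘ injective i<M k<M)) (sym (δ-≢ i≢k))

before-applyUpTo : ∀ E M {i j} → InjectiveBelow E M → i < M → j < M → before (E i) (E j) (applyUpTo E M) ≡ χ< i j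
before-applyUpTo E (suc M) {zero} {zero} injective _ _ =
  cong₂ _+_ (trans (cong (δ (E 0) (E 0) *_) (head-∉-tail injective)) (*-zeroʳ (δ (E 0) (E 0))))
            (before-absentˡ (E 0) (E 0) (applyUpTo (E ∘ suc) M) (head-∉-tail injective))
before-applyUpTo E (suc M) {zero} {suc j} injective _ (s≤s j<M) =
  cong₂ _+_ (cong₂ _*_ (δ-refl (E 0)) (occ-applyUpTo (E ∘ suc) M (injective-suc injective) j<M))
            (before-absentˡ (E 0) (E (suc j)) (applyUpTo (E ∘ suc) M) (head-∉-tail injective))
before-applyUpTo E (suc M) {suc i} {zero} injective (s≤s i<M) _ =
  cong₂ _+_ (cong (_* occ (E 0) (applyUpTo (E ∘ suc) M)) (δ-≢ (head-unique injective i<M)))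
            (before-absentʳ (E (suc i)) (E 0) (applyUpTo (E ∘ suc) M) (head-∉-tail injective))
before-applyUpTo E (suc M) {suc i} {suc j} injective (s≤s i<M) (s≤s j<M) =
  cong₂ _+_ (cong (_* occ (E (suc j)) (applyUpTo (E ∘ suc) M)) (δ-≢ (head-unique injective i<M)))
            (before-applyUpTo (E ∘ suc) M (injective-suc injective) i<M j<M)

adjacent-applyUpTo : ∀ E M {i j} → InjectiveBelow E M → i < M → j < M →
  adjacent (E j) (E i) (applyUpTo E M) ≡ δ (suc j) i
adjacent-applyUpTo E 1 {zero}  {zero}  _ _         _         = refl
adjacent-applyUpTo E 1 {suc _} {_}     _ (s≤s ()) _
adjacent-applyUpTo E 1 {_}     {suc _} _ _         (s≤s ())
adjacent-applyUpTo E (suc (suc M)) {i} {zero} injective i<M _ =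
  cong₂ _+_ (trans (cong₂ _*_ (δ-refl (E 0)) (δ-applyUpTo E (suc (suc M)) injective i<M (s≤s (s≤s z≤n))))
                   (trans (+-identityʳ (δ i 1)) (δ-sym i 1)))
            (adjacent-absentˡ (E 0) (E i) (applyUpTo (E ∘ suc) (suc M)) (head-∉-tail injective))
  ∙ +-identityʳ (δ 1 i)
  where _∙_ = trans
adjacent-applyUpTo E (suc (suc M)) {zero} {suc j} injective _ (s≤s j<M) =
  cong₂ _+_ (cong (_* δ (E 0) (E 1)) (δ-≢ (head-unique injective j<M)))
            (adjacent-absentʳ (E (suc j)) (E 0) (applyUpTo (E ∘ suc) (suc M)) (head-∉-tail injective))
adjacent-applyUpTo E (suc (suc M)) {suc i} {suc j} injective (s≤s i<M) (s≤s j<M) =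
  cong₂ _+_ (cong (_* δ (E (suc i)) (E 1)) (δ-≢ (head-unique injective j<M)))
            (adjacent-applyUpTo (E ∘ suc) (suc M) (injective-suc injective) i<M j<M)

adjSum-applyUpTo : ∀ h E M → adjSum h (applyUpTo E (suc M)) ≡ sumBelow (λ v → h (E v , E (suc v))) M
adjSum-applyUpTo h E zero    = refl
adjSum-applyUpTo h E (suc M) =
  trans (cong (h (E 0 , E 1) +_) (adjSum-applyUpTo h (E ∘ suc) M))
        (sym (sumBelow-suc (λ v → h (E v , E (suc v))) M))

-- Extended words of permutations

lookupOr : ∀ {n} → (Fin n → ℕ) → ℕ → ℕ → ℕ
lookupOr {zero}  h d k       = d
lookupOr {suc n} h d zero    = h fzero
lookupOr {suc n} h d (suc k) = lookupOr (h ∘ fsuc) d k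

tabulate-∷ʳ : ∀ {n} (h : Fin n → ℕ) d → tabulate h ++ [ d ] ≡ applyUpTo (lookupOr h d) (suc n)
tabulate-∷ʳ {zero}  h d = refl
tabulate-∷ʳ {suc n} h d = cong (h fzero ∷_) (tabulate-∷ʳ (h ∘ fsuc) d)

lookupOr-toℕ : ∀ {n} (h : Fin n → ℕ) d (i : Fin n) → lookupOr h d (toℕ i) ≡ h i
lookupOr-toℕ h d fzero    = refl
lookupOr-toℕ h d (fsuc i) = lookupOr-toℕ (h ∘ fsuc) d i

lookupOr-length : ∀ {n} (h : Fin n → ℕ) d → lookupOr h d n ≡ d
lookupOr-length {zero}  h d = refl
lookupOr-length {suc n} h d = lookupOr-length (h ∘ fsuc) d

lookupOr-≤ : ∀ {n} (h : Fin n → ℕ) d k → (∀ i → h i ≤ d) → lookupOr h d k ≤ d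
lookupOr-≤ {zero}  h d k       h≤d = ≤-refl
lookupOr-≤ {suc n} h d zero    h≤d = h≤d fzero
lookupOr-≤ {suc n} h d (suc k) h≤d = lookupOr-≤ (h ∘ fsuc) d k (h≤d ∘ fsuc)

-- entry f k is the k-th letter of the extended word 0 (f 0 + 1) … (f (n-1) + 1) (n+1).
entry : ∀ {n} → (Fin n → Fin n) → ℕ → ℕ
entry     f zero    = zero
entry {n} f (suc k) = lookupOr (λ i → suc (toℕ (f i))) (suc n) k

extend-oneLine : ∀ {n} (f : Fin n → Fin n) → extend n (oneLine f) ≡ applyUpTo (entry f) (suc (suc n))
extend-oneLine {n} f = cong (0 ∷_)
  (trans (cong (_++ [ suc n ]) (map-tabulate (λ i → i) (λ i → suc (toℕ (f i)))))
         (tabulate-∷ʳ (λ i → suc (toℕ (f i))) (suc n)))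

extend-idWord : ∀ n → extend n (idWord n) ≡ applyUpTo (λ k → k) (suc (suc n))
extend-idWord n = cong (0 ∷_) (trans (cong (_++ [ suc n ]) (map-applyUpTo (λ k → k) suc n)) (applyUpTo-∷ʳ suc n))

entry-< : ∀ {n} (f : Fin n → Fin n) v → entry f v < suc (suc n)
entry-< f zero    = s≤s z≤n
entry-< f (suc k) = s≤s (lookupOr-≤ (λ i → suc (toℕ (f i))) _ k (λ i → m≤n⇒m≤1+n (toℕ<n (f i))))

entry-inverse : ∀ {n} (f g : Fin n → Fin n) → (∀ i → f (g i) ≡ i) →
  ∀ {v} → v < suc (suc n) → entry f (entry g v) ≡ v
entry-inverse f g f∘g {zero}  _ = refl
entry-inverse {n} f g f∘g {suc k} (s≤s k≤n) with k <? n
... | yes k<n = begin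
  entry f (lookupOr ĝ (suc n) k)                    ≡⟨ cong (entry f ∘ lookupOr ĝ (suc n)) (sym (toℕ-fromℕ< k<n)) ⟩
  entry f (lookupOr ĝ (suc n) (toℕ (fromℕ< k<n)))   ≡⟨ cong (entry f) (lookupOr-toℕ ĝ (suc n) (fromℕ< k<n)) ⟩
  lookupOr f̂ (suc n) (toℕ (g (fromℕ< k<n)))         ≡⟨ lookupOr-toℕ f̂ (suc n) (g (fromℕ< k<n)) ⟩
  suc (toℕ (f (g (fromℕ< k<n))))                    ≡⟨ cong (suc ∘ toℕ) (f∘g (fromℕ< k<n)) ⟩
  suc (toℕ (fromℕ< k<n))                            ≡⟨ cong suc (toℕ-fromℕ< k<n) ⟩
  suc k                                             ∎
  where
  open ≡-Reasoning
  f̂ ĝ : Fin n → ℕ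
  f̂ i = suc (toℕ (f i))
  ĝ i = suc (toℕ (g i))
... | no  k≮n rewrite ≤-antisym (s≤s⁻¹ k≤n) (≮⇒≥ k≮n) =
  trans (cong (entry f) (lookupOr-length (λ i → suc (toℕ (g i))) (suc n)))
        (lookupOr-length (λ i → suc (toℕ (f i))) (suc n))

entry-injective : ∀ {n} (f g : Fin n → Fin n) → (∀ i → g (f i) ≡ i) → InjectiveBelow (entry f) (suc (suc n))
entry-injective f g g∘f i<N j<N fi≡fj =
  trans (sym (entry-inverse g f g∘f i<N)) (trans (cong (entry g) fi≡fj) (entry-inverse g f g∘f j<N))

identity-injective : ∀ M → InjectiveBelow (λ k → k) M
identity-injective M _ _ i≡j = i≡j

adjSum-identity : ∀ h → (∀ v → h (v , suc v) ≡ 0) → ∀ n → adjSum h (extend n (idWord n)) ≡ 0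
adjSum-identity h h-succ n =
  trans (cong (adjSum h) (extend-idWord n))
        (trans (adjSum-applyUpTo h (λ k → k) (suc n)) (sumBelow-zero (suc n) (λ v _ → h-succ v)))

des⁻¹-identity : ∀ n → des⁻¹ (suc n) (extend n (idWord n)) ≡ 0
des⁻¹-identity n = trans (cong (des⁻¹ (suc n)) (extend-idWord n)) (sumBelow-zero (suc n) λ v v<1+n →
  trans (before-applyUpTo (λ k → k) (suc (suc n)) (identity-injective _) (s≤s v<1+n) (m<n⇒m<1+n v<1+n))
        (χ<-≥ (n≤1+n v)))

gap⁻¹-identity : ∀ n → gap⁻¹ (suc n) (extend n (idWord n)) ≡ 0
gap⁻¹-identity n = trans (cong (gap⁻¹ (suc n)) (extend-idWord n)) (sumBelow-zero (suc n) λ v v<1+n →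
  cong₂ _∸_
    (trans (before-applyUpTo (λ k → k) (suc (suc n)) (identity-injective _) (m<n⇒m<1+n v<1+n) (s≤s v<1+n)) (χ<-< (n<1+n v)))
    (trans (adjacent-applyUpTo (λ k → k) (suc (suc n)) (identity-injective _) (s≤s v<1+n) (m<n⇒m<1+n v<1+n)) (δ-refl (suc v))))

module _ {n : ℕ} (π : Permutation′ n) where
  private
    F G : ℕ → ℕ
    F = entry (π ⟨$⟩ʳ_)
    G = entry (π ⟨$⟩ˡ_)

    F-injective : InjectiveBelow F (suc (suc n))
    F-injective = entry-injective (π ⟨$⟩ʳ_) (π ⟨$⟩ˡ_) (λ _ → inverseˡ π)

    F∘G : ∀ {v} → v < suc (suc n) → F (G v) ≡ v
    F∘G = entry-inverse (π ⟨$⟩ʳ_) (π ⟨$⟩ˡ_) (λ _ → inverseʳ π)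

    before-G : ∀ {v w} → v < suc (suc n) → w < suc (suc n) → before v w (extend n (word π)) ≡ χ< (G v) (G w)
    before-G {v} {w} v<N w<N = begin
      before v w (extend n (word π))
        ≡⟨ cong₂ (λ a b → before a b (extend n (word π))) (sym (F∘G v<N)) (sym (F∘G w<N)) ⟩
      before (F (G v)) (F (G w)) (extend n (word π))
        ≡⟨ cong (before (F (G v)) (F (G w))) (extend-oneLine (π ⟨$⟩ʳ_)) ⟩
      before (F (G v)) (F (G w)) (applyUpTo F (suc (suc n)))
        ≡⟨ before-applyUpTo F _ F-injective (entry-< _ v) (entry-< _ w) ⟩
      χ< (G v) (G w)
        ∎
      where open ≡-Reasoning

    adjacent-G : ∀ {v w} → v < suc (suc n) → w < suc (suc n) →
      adjacent v w (extend n (word π)) ≡ δ (suc (G v)) (G w)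
    adjacent-G {v} {w} v<N w<N = begin
      adjacent v w (extend n (word π))
        ≡⟨ cong₂ (λ a b → adjacent a b (extend n (word π))) (sym (F∘G v<N)) (sym (F∘G w<N)) ⟩
      adjacent (F (G v)) (F (G w)) (extend n (word π))
        ≡⟨ cong (adjacent (F (G v)) (F (G w))) (extend-oneLine (π ⟨$⟩ʳ_)) ⟩
      adjacent (F (G v)) (F (G w)) (applyUpTo F (suc (suc n)))
        ≡⟨ adjacent-applyUpTo F _ F-injective (entry-< _ w) (entry-< _ v) ⟩
      δ (suc (G v)) (G w)
        ∎
      where open ≡-Reasoning

    G-≢-suc : ∀ {v} → v < suc n → G v ≢ G (suc v)
    G-≢-suc v<1+n Gv≡Gv+1 =
      1+n≢n (sym (trans (sym (F∘G (m<n⇒m<1+n v<1+n))) (trans (cong F Gv≡Gv+1) (F∘G (s≤s v<1+n)))))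

    countInv : ∀ h → adjSum h (extend n (wordInv π)) ≡ sumBelow (λ v → h (G v , G (suc v))) (suc n)
    countInv h = trans (cong (adjSum h) (extend-oneLine (π ⟨$⟩ˡ_))) (adjSum-applyUpTo h G (suc n))

  distinct-word : Distinct (extend n (word π))
  distinct-word = subst Distinct (sym (extend-oneLine (π ⟨$⟩ʳ_))) (distinct-applyUpTo F _ F-injective)

  desInv≡des⁻¹ : desInv π ≡ des⁻¹ (suc n) (extend n (word π))
  desInv≡des⁻¹ = trans (countInv isDes) (sumBelow-cong (suc n) λ v v<1+n →
    trans (isDes≡χ< (G v) (G (suc v))) (sym (before-G (s≤s v<1+n) (m<n⇒m<1+n v<1+n))))

  gapInv≡gap⁻¹ : gapInv π ≡ gap⁻¹ (suc n) (extend n (word π))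
  gapInv≡gap⁻¹ = trans (countInv isGap) (sumBelow-cong (suc n) λ v v<1+n →
    trans (isGap≡χ<∸δ (G v) (G (suc v)) (G-≢-suc v<1+n))
          (sym (cong₂ _∸_ (before-G (m<n⇒m<1+n v<1+n) (s≤s v<1+n)) (adjacent-G (m<n⇒m<1+n v<1+n) (s≤s v<1+n)))))

sorting-bound : ∀ Φ {k n} (π : Permutation′ n) {m} → DropsBy Φ k → Φ (extend n (idWord n)) ≡ 0 →
  Sorts π m → Φ (extend n (word π)) ≤ k * m
sorting-bound Φ {k} {n} π {m} drops Φ-identity sorts =
  subst (λ t → Φ (extend n (word π)) ≤ t + k * m) Φ-identity (drop-moves {Φ} drops n sorts (distinct-word π))

theorem1 : ∀ (n : ℕ) (π : Permutation′ n) (m : ℕ) → IsBc π m →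
    (bp π ≤ 3 * m) × (des π ≤ m) × (gap π ≤ 2 * m) × (desInv π ≤ m) × (gapInv π ≤ 2 * m)
theorem1 n π m (sorts , _) =
    sorting-bound countBp π bp-drop (adjSum-identity isBp isBp-succ n) sorts
  , subst (des π ≤_) (*-identityˡ m)
      (sorting-bound countDes π des-drop (adjSum-identity isDes isDes-succ n) sorts)
  , sorting-bound countGap π gap-drop (adjSum-identity isGap isGap-succ n) sorts
  , subst₂ _≤_ (sym (desInv≡des⁻¹ π)) (*-identityˡ m)
      (sorting-bound (des⁻¹ (suc n)) π (des⁻¹-drop (suc n)) (des⁻¹-identity n) sorts)
  , subst (_≤ 2 * m) (sym (gapInv≡gap⁻¹ π))
      (sorting-bound (gap⁻¹ (suc n)) π (gap⁻¹-drop (suc n)) (gap⁻¹-identity n) sorts)
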